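{- For every integer $n\geq 1$, \[ \sum_{k=1}^n \frac{2^{2k}}{\binom{2k}{k}} H_{k}^2 = \frac{44}{27} + \frac{2^{2n+1}}{3 \binom{2n}{n}}\left ((n+1)H_{n}^2 - \frac{2(2n-1)}{3}H_n + \frac{8n-22}{9} \right ) + \frac{1}{3} \sum_{k=1}^n \frac{2^{2k}}{k^2\,\binom{2k}{k}} \] and \[ \sum_{k=1}^n \frac{2^{2k}}{\binom{2k}{k}} H_{k}^{(2)} = \frac{4}{3} + \frac{2^{2n+1}}{3 \binom{2n}{n}}\left ((n+1)H_{n}^{(2)} - 2 \right ) + \frac{1}{3} \sum_{k=1}^n \frac{2^{2k}}{k^2\,\binom{2k}{k}}. \]
   Context: $H_n=\sum_{j=1}^n 1/j$, $H_n^2=(H_n)^2$, and $H_n^{(2)}=\sum_{j=1}^n 1/j^2$. -}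

module Defs where

open import Data.Nat as ℕ using (ℕ; zero; suc; _^_)
open import Data.Nat.Combinatorics using (_C_)
open import Data.Integer using (+_)
open import Data.Rational using (ℚ; 0ℚ; _+_; _*_; _/_)

-- a / d as a rational, for natural numbers a, d.
-- Convention d = 0 ↦ 0; it is only ever used with provably nonzero
-- denominators (j, j², binomial (2k choose k)), so the convention is inert.
_//_ : ℕ → ℕ → ℚ
a // zero = 0ℚ
a // suc d = (+ a) / suc d

sum1to : ℕ → (ℕ → ℚ) → ℚ
sum1to zero f = 0ℚ
sum1to (suc n) f = sum1to n f + f (suc n)

H : ℕ → ℚ
H n = sum1to n (λ j → 1 // j)

H2 : ℕ → ℚ
H2 n = sum1to n (λ j → 1 // (j ℕ.* j))

cbin : ℕ → ℕ
cbin k = (2 ℕ.* k) C k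

w : ℕ → ℚ
w k = (2 ^ (2 ℕ.* k)) // cbin k

-- Both sides vanish at n = 0, so it suffices to compare increments. Write
-- V = w (n+1), a = 1/(n+1) and N = n. The central binomial recurrence
-- (n+1)·C(2n+2,n+1) = 2(2n+1)·C(2n,n) gives w n = (1 − a/2)·V. After this
-- substitution, the increment of each closed form minus the new summand
-- V·H²ₙ₊₁ (resp. V·H⁽²⁾ₙ₊₁) is a polynomial in V, Hₙ, a, N that is divisible
-- by a(N + 1) − 1, so it vanishes.

module Submission where

open import Defs
open import Data.Nat as ℕ using (ℕ; suc; _≥_; _^_)
open import Data.Integer using (+_)
open import Data.Rational using (ℚ; _+_; _*_; _-_; _/_)
open import Data.Product using (_×_)
open import Relation.Binary.PropositionalEquality using (_≡_)

open import Level using (0ℓ)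
open import Algebra.Bundles.Raw using (RawRing)
open import Data.List using (_∷_; [])
open import Data.Product using (_,_)
open import Data.Nat using (zero; _∸_; _≤_; _!; NonZero; ≢-nonZero; ≢-nonZero⁻¹)
import Data.Nat.Properties as ℕₚ
open import Data.Nat.Combinatorics using (_C_; nCk≡n!/k![n-k]!; k![n∸k]!∣n!)
open import Data.Nat.DivMod using (m/n*n≡m)
open import Data.Nat.Tactic.RingSolver using (solve; solve-∀)
import Data.Integer as ℤ
import Data.Integer.Properties as ℤₚ
open import Data.Rational using (0ℚ; 1ℚ; ½; -½; toℚᵘ; fromℚᵘ; +-*-rawRing)
open import Data.Rational.Properties
  using (toℚᵘ-injective; toℚᵘ-fromℚᵘ; fromℚᵘ-cong; toℚᵘ-homo-*; toℚᵘ-homo-+; /-cong;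
         +-inverseʳ; +-identityʳ; *-zeroˡ; *-zeroʳ; *-comm)
import Data.Rational.Unnormalised as ℚᵘ
import Data.Rational.Unnormalised.Properties as ℚᵘₚ
open import Data.Rational.Solver using (module +-*-Solver)
open import Relation.Binary.PropositionalEquality using (refl; sym; trans; cong; cong₂; module ≡-Reasoning)

open +-*-Solver using (Polynomial; con; _:+_; _:*_; _:-_; :-_; _:=_)
  renaming (solve to solveℚ)

nCk*[k!*[n∸k]!]≡n! : ∀ {n k} → k ≤ n → (n C k) ℕ.* (k ! ℕ.* (n ∸ k) !) ≡ n !
nCk*[k!*[n∸k]!]≡n! {n} {k} k≤n =
  trans (cong (ℕ._* (k ! ℕ.* (n ∸ k) !)) (nCk≡n!/k![n-k]! k≤n))
        (m/n*n≡m {{k ℕₚ.!* (n ∸ k) !≢0}} (k![n∸k]!∣n! k≤n))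

cbin*[k!*k!]≡[2k]! : ∀ k → cbin k ℕ.* (k ! ℕ.* k !) ≡ (2 ℕ.* k) !
cbin*[k!*k!]≡[2k]! k = begin
  cbin k ℕ.* (k ! ℕ.* k !)              ≡⟨ cong (λ m → cbin k ℕ.* (k ! ℕ.* m !)) 2k∸k≡k ⟨
  cbin k ℕ.* (k ! ℕ.* (2 ℕ.* k ∸ k) !)  ≡⟨ nCk*[k!*[n∸k]!]≡n! (ℕₚ.m≤m+n k (k ℕ.+ 0)) ⟩
  (2 ℕ.* k) !                           ∎
  where
  open ≡-Reasoning
  2k∸k≡k : 2 ℕ.* k ∸ k ≡ k
  2k∸k≡k = trans (ℕₚ.m+n∸m≡n k (k ℕ.+ 0)) (ℕₚ.+-identityʳ k)

cbin-nonZero : ∀ k → NonZero (cbin k)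
cbin-nonZero k = ≢-nonZero λ cbin≡0 →
  ≢-nonZero⁻¹ ((2 ℕ.* k) !) {{(2 ℕ.* k) ℕₚ.!≢0}}
    (trans (sym (cbin*[k!*k!]≡[2k]! k)) (cong (ℕ._* (k ! ℕ.* k !)) cbin≡0))

cbin-suc : ∀ k → suc k ℕ.* cbin (suc k) ≡ 2 ℕ.* (2 ℕ.* k ℕ.+ 1) ℕ.* cbin k
cbin-suc k = ℕₚ.*-cancelʳ-≡ _ _ (suc k ℕ.* (k ! ℕ.* k !)) {{ℕₚ.m*n≢0 (suc k) _ {{_}} {{k ℕₚ.!* k !≢0}}}} (begin
  suc k ℕ.* cbin (suc k) ℕ.* (suc k ℕ.* (k ! ℕ.* k !))
    ≡⟨ square-suc (cbin (suc k)) k (k !) ⟩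
  cbin (suc k) ℕ.* (suc k ! ℕ.* suc k !)
    ≡⟨ cbin*[k!*k!]≡[2k]! (suc k) ⟩
  (2 ℕ.* suc k) !
    ≡⟨ cong _! (ℕₚ.*-distribˡ-+ 2 1 k) ⟩
  (2 ℕ.+ 2 ℕ.* k) !
    ≡⟨ cong (λ m → (2 ℕ.+ 2 ℕ.* k) ℕ.* ((1 ℕ.+ 2 ℕ.* k) ℕ.* m)) (cbin*[k!*k!]≡[2k]! k) ⟨
  (2 ℕ.+ 2 ℕ.* k) ℕ.* ((1 ℕ.+ 2 ℕ.* k) ℕ.* (cbin k ℕ.* (k ! ℕ.* k !)))
    ≡⟨ regroup (cbin k) k (k !) ⟩
  2 ℕ.* (2 ℕ.* k ℕ.+ 1) ℕ.* cbin k ℕ.* (suc k ℕ.* (k ! ℕ.* k !)) ∎)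
  where
  open ≡-Reasoning
  square-suc : ∀ c m f → suc m ℕ.* c ℕ.* (suc m ℕ.* (f ℕ.* f)) ≡ c ℕ.* ((suc m ℕ.* f) ℕ.* (suc m ℕ.* f))
  square-suc = solve-∀
  regroup : ∀ c m f → (2 ℕ.+ 2 ℕ.* m) ℕ.* ((1 ℕ.+ 2 ℕ.* m) ℕ.* (c ℕ.* (f ℕ.* f)))
                      ≡ 2 ℕ.* (2 ℕ.* m ℕ.+ 1) ℕ.* c ℕ.* (suc m ℕ.* (f ℕ.* f))
  regroup = solve-∀

fromℚᵘ-homo-* : ∀ p q → fromℚᵘ (p ℚᵘ.* q) ≡ fromℚᵘ p * fromℚᵘ q
fromℚᵘ-homo-* p q = toℚᵘ-injective (begin
  toℚᵘ (fromℚᵘ (p ℚᵘ.* q))              ≈⟨ toℚᵘ-fromℚᵘ (p ℚᵘ.* q) ⟩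
  p ℚᵘ.* q                              ≈⟨ ℚᵘₚ.*-cong (toℚᵘ-fromℚᵘ p) (toℚᵘ-fromℚᵘ q) ⟨
  toℚᵘ (fromℚᵘ p) ℚᵘ.* toℚᵘ (fromℚᵘ q)  ≈⟨ toℚᵘ-homo-* (fromℚᵘ p) (fromℚᵘ q) ⟨
  toℚᵘ (fromℚᵘ p * fromℚᵘ q)            ∎)
  where open ℚᵘₚ.≃-Reasoning

fromℚᵘ-homo-+ : ∀ p q → fromℚᵘ (p ℚᵘ.+ q) ≡ fromℚᵘ p + fromℚᵘ q
fromℚᵘ-homo-+ p q = toℚᵘ-injective (begin
  toℚᵘ (fromℚᵘ (p ℚᵘ.+ q))              ≈⟨ toℚᵘ-fromℚᵘ (p ℚᵘ.+ q) ⟩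
  p ℚᵘ.+ q                              ≈⟨ ℚᵘₚ.+-cong (toℚᵘ-fromℚᵘ p) (toℚᵘ-fromℚᵘ q) ⟨
  toℚᵘ (fromℚᵘ p) ℚᵘ.+ toℚᵘ (fromℚᵘ q)  ≈⟨ toℚᵘ-homo-+ (fromℚᵘ p) (fromℚᵘ q) ⟨
  toℚᵘ (fromℚᵘ p + fromℚᵘ q)            ∎)
  where open ℚᵘₚ.≃-Reasoning

//-* : ∀ a b c d → a // b * (c // d) ≡ (a ℕ.* c) // (b ℕ.* d)
//-* a zero    c d       = *-zeroˡ (c // d)
//-* a (suc b) c zero    = trans (*-zeroʳ (a // suc b)) (cong ((a ℕ.* c) //_) (sym (ℕₚ.*-zeroʳ (suc b))))
//-* a (suc b) c (suc d) =
  trans (sym (fromℚᵘ-homo-* (ℚᵘ.mkℚᵘ (+ a) b) (ℚᵘ.mkℚᵘ (+ c) d))) (/-cong (sym (ℤₚ.pos-* a c)) refl)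

//-cross : ∀ a b c d .{{_ : NonZero b}} .{{_ : NonZero d}} → a ℕ.* d ≡ c ℕ.* b → a // b ≡ c // d
//-cross a (suc b) c (suc d) ad≡cb = fromℚᵘ-cong {ℚᵘ.mkℚᵘ (+ a) b} {ℚᵘ.mkℚᵘ (+ c) d} (ℚᵘ.*≡*
  (trans (sym (ℤₚ.pos-* a (suc d))) (trans (cong +_ ad≡cb) (ℤₚ.pos-* c (suc b)))))

fromℕ : ℕ → ℚ
fromℕ n = n // 1

fromℕ-*-// : ∀ m a b → fromℕ m * (a // b) ≡ (m ℕ.* a) // b
fromℕ-*-// m a b = trans (//-* m 1 a b) (cong ((m ℕ.* a) //_) (ℕₚ.*-identityˡ b))

fromℕ-* : ∀ m n → fromℕ (m ℕ.* n) ≡ fromℕ m * fromℕ n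
fromℕ-* m n = sym (fromℕ-*-// m n 1)

fromℕ-+ : ∀ m n → fromℕ (m ℕ.+ n) ≡ fromℕ m + fromℕ n
fromℕ-+ m n = trans (/-cong +[m+n]≡+m*1+n*1 refl) (fromℚᵘ-homo-+ (ℚᵘ.mkℚᵘ (+ m) 0) (ℚᵘ.mkℚᵘ (+ n) 0))
  where
  +[m+n]≡+m*1+n*1 : + (m ℕ.+ n) ≡ + m ℤ.* + 1 ℤ.+ + n ℤ.* + 1
  +[m+n]≡+m*1+n*1 = trans (ℤₚ.pos-+ m n) (sym (cong₂ ℤ._+_ (ℤₚ.*-identityʳ (+ m)) (ℤₚ.*-identityʳ (+ n))))

fromℕ-suc : ∀ n → fromℕ (suc n) ≡ fromℕ n + 1ℚ
fromℕ-suc n = trans (cong fromℕ (ℕₚ.+-comm 1 n)) (fromℕ-+ n 1)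

fromℕ-2n+1 : ∀ n → fromℕ (2 ℕ.* n ℕ.+ 1) ≡ + 2 / 1 * fromℕ n + 1ℚ
fromℕ-2n+1 n = trans (fromℕ-+ (2 ℕ.* n) 1) (cong (_+ 1ℚ) (fromℕ-* 2 n))

1//[1+n]*[n+1]≡1 : ∀ n → 1 // suc n * (fromℕ n + 1ℚ) ≡ 1ℚ
1//[1+n]*[n+1]≡1 n = begin
  1 // suc n * (fromℕ n + 1ℚ)  ≡⟨ cong (_*_ (1 // suc n)) (fromℕ-suc n) ⟨
  1 // suc n * fromℕ (suc n)   ≡⟨ *-comm (1 // suc n) (fromℕ (suc n)) ⟩
  fromℕ (suc n) * (1 // suc n) ≡⟨ fromℕ-*-// (suc n) 1 (suc n) ⟩
  (suc n ℕ.* 1) // suc n       ≡⟨ //-cross (suc n ℕ.* 1) (suc n) 1 1 (solve (n ∷ [])) ⟩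
  1ℚ                           ∎
  where open ≡-Reasoning

2^[2+2n]≡4*2^[2n] : ∀ n → 2 ^ (2 ℕ.* suc n) ≡ 4 ℕ.* 2 ^ (2 ℕ.* n)
2^[2+2n]≡4*2^[2n] n = trans (cong (2 ^_) (ℕₚ.*-distribˡ-+ 2 1 n)) (sym (ℕₚ.*-assoc 2 2 (2 ^ (2 ℕ.* n))))

w-ratio : ∀ n → (+ 2 / 1 * fromℕ n + 1ℚ) * w (suc n) ≡ + 2 / 1 * (fromℕ n + 1ℚ) * w n
w-ratio n = begin
  (+ 2 / 1 * fromℕ n + 1ℚ) * w (suc n)
    ≡⟨ cong (_* w (suc n)) (fromℕ-2n+1 n) ⟨
  fromℕ (2 ℕ.* n ℕ.+ 1) * w (suc n)
    ≡⟨ fromℕ-*-// (2 ℕ.* n ℕ.+ 1) (2 ^ (2 ℕ.* suc n)) (cbin (suc n)) ⟩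
  ((2 ℕ.* n ℕ.+ 1) ℕ.* 2 ^ (2 ℕ.* suc n)) // cbin (suc n)
    ≡⟨ //-cross _ _ _ _ {{cbin-nonZero (suc n)}} {{cbin-nonZero n}} cross ⟩
  (2 ℕ.* suc n ℕ.* p) // cbin n
    ≡⟨ fromℕ-*-// (2 ℕ.* suc n) p (cbin n) ⟨
  fromℕ (2 ℕ.* suc n) * w n
    ≡⟨ cong (_* w n) (trans (fromℕ-* 2 (suc n)) (cong (_*_ (+ 2 / 1)) (fromℕ-suc n))) ⟩
  + 2 / 1 * (fromℕ n + 1ℚ) * w n
    ∎
  where
  open ≡-Reasoning
  p : ℕ
  p = 2 ^ (2 ℕ.* n)
  regroup₁ : ∀ m q c → (2 ℕ.* m ℕ.+ 1) ℕ.* (4 ℕ.* q) ℕ.* c ≡ 2 ℕ.* q ℕ.* (2 ℕ.* (2 ℕ.* m ℕ.+ 1) ℕ.* c)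
  regroup₁ = solve-∀
  regroup₂ : ∀ m q c → 2 ℕ.* q ℕ.* (suc m ℕ.* c) ≡ 2 ℕ.* suc m ℕ.* q ℕ.* c
  regroup₂ = solve-∀
  cross : (2 ℕ.* n ℕ.+ 1) ℕ.* 2 ^ (2 ℕ.* suc n) ℕ.* cbin n ≡ 2 ℕ.* suc n ℕ.* p ℕ.* cbin (suc n)
  cross = begin
    (2 ℕ.* n ℕ.+ 1) ℕ.* 2 ^ (2 ℕ.* suc n) ℕ.* cbin n  ≡⟨ cong (λ q → (2 ℕ.* n ℕ.+ 1) ℕ.* q ℕ.* cbin n) (2^[2+2n]≡4*2^[2n] n) ⟩
    (2 ℕ.* n ℕ.+ 1) ℕ.* (4 ℕ.* p) ℕ.* cbin n          ≡⟨ regroup₁ n p (cbin n) ⟩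
    2 ℕ.* p ℕ.* (2 ℕ.* (2 ℕ.* n ℕ.+ 1) ℕ.* cbin n)    ≡⟨ cong (2 ℕ.* p ℕ.*_) (cbin-suc n) ⟨
    2 ℕ.* p ℕ.* (suc n ℕ.* cbin (suc n))              ≡⟨ regroup₂ n p (cbin (suc n)) ⟩
    2 ℕ.* suc n ℕ.* p ℕ.* cbin (suc n)                ∎

+-vanishing : ∀ x y {p q} → p ≡ q → x + y * (p - q) ≡ x
+-vanishing x y {p} refl = begin
  x + y * (p - p)  ≡⟨ cong (λ z → x + y * z) (+-inverseʳ p) ⟩
  x + y * 0ℚ       ≡⟨ cong (_+_ x) (*-zeroʳ y) ⟩
  x + 0ℚ           ≡⟨ +-identityʳ x ⟩
  x                ∎
  where open ≡-Reasoning

w-pred : ∀ n → w n ≡ w (suc n) - ½ * (1 // suc n) * w (suc n)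
w-pred n = begin
  W
    ≡⟨ certificate ⟩
  V - ½ * a * V + (V - W) * (a * (N + 1ℚ) - 1ℚ) + -½ * a * ((+ 2 / 1 * N + 1ℚ) * V - + 2 / 1 * (N + 1ℚ) * W)
    ≡⟨ +-vanishing _ (-½ * a) (w-ratio n) ⟩
  V - ½ * a * V + (V - W) * (a * (N + 1ℚ) - 1ℚ)
    ≡⟨ +-vanishing _ (V - W) (1//[1+n]*[n+1]≡1 n) ⟩
  V - ½ * a * V
    ∎
  where
  open ≡-Reasoning
  W V a N : ℚ
  W = w n
  V = w (suc n)
  a = 1 // suc n
  N = fromℕ n
  certificate :
    W ≡ V - ½ * a * V + (V - W) * (a * (N + 1ℚ) - 1ℚ) + -½ * a * ((+ 2 / 1 * N + 1ℚ) * V - + 2 / 1 * (N + 1ℚ) * W)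
  certificate = solveℚ 4 (λ W V a N →
    W := V :- con ½ :* a :* V :+ (V :- W) :* (a :* (N :+ con 1ℚ) :- con 1ℚ)
         :+ con -½ :* a :* ((con (+ 2 / 1) :* N :+ con 1ℚ) :* V :- con (+ 2 / 1) :* (N :+ con 1ℚ) :* W)) refl W V a N

-- The closed forms are written over any raw ring with rational constants κ, so
-- that the same expressions serve as ℚ-valued functions and as input
-- polynomials for the ring solver.
module ClosedForms (R : RawRing 0ℓ 0ℓ) (κ : ℚ → RawRing.Carrier R) where
  open RawRing R using (Carrier; 1#)
    renaming (_+_ to infixl 6 _⊕_; _*_ to infixl 7 _⊛_; -_ to infix 8 ⊖_)

  infixl 6 _⊝_
  _⊝_ : Carrier → Carrier → Carrier
  x ⊝ y = x ⊕ ⊖ y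

  closed₁ closed₂ : Carrier → Carrier → Carrier → Carrier → Carrier
  closed₁ W h N S =
    κ (+ 44 / 27)
    ⊕ κ (+ 2 / 3) ⊛ W ⊛ ((N ⊕ 1#) ⊛ (h ⊛ h) ⊝ κ (+ 2 / 3) ⊛ (κ (+ 2 / 1) ⊛ N ⊝ 1#) ⊛ h
                       ⊕ (κ (+ 8 / 1) ⊛ N ⊝ κ (+ 22 / 1)) ⊛ κ (+ 1 / 9))
    ⊕ κ (+ 1 / 3) ⊛ S
  closed₂ W g N S = κ (+ 4 / 3) ⊕ κ (+ 2 / 3) ⊛ W ⊛ ((N ⊕ 1#) ⊛ g ⊝ κ (+ 2 / 1)) ⊕ κ (+ 1 / 3) ⊛ S

open ClosedForms +-*-rawRing (λ c → c)

-- The solver never looks at the equality field, so it is just ≡.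
polynomialRawRing : ℕ → RawRing 0ℓ 0ℓ
polynomialRawRing m = record
  { Carrier = Polynomial m
  ; _≈_     = _≡_
  ; _+_     = _:+_
  ; _*_     = _:*_
  ; -_      = :-_
  ; 0#      = con 0ℚ
  ; 1#      = con 1ℚ
  }

module Poly {m} = ClosedForms (polynomialRawRing m) con

-- With a = 1/(N+1) the identity is not polynomial; the certificate shows that
-- the two sides differ by a polynomial multiple of a(N + 1) − 1.
closed₁-step : ∀ V h a N S → a * (N + 1ℚ) ≡ 1ℚ →
  closed₁ V (h + a) (N + 1ℚ) (S + V * (a * a)) ≡ closed₁ (V - ½ * a * V) h N S + V * ((h + a) * (h + a))
closed₁-step V h a N S a[N+1]≡1 = begin
  closed₁ V (h + a) (N + 1ℚ) (S + V * (a * a))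
    ≡⟨ certificate ⟩
  closed₁ (V - ½ * a * V) h N S + V * ((h + a) * (h + a)) + V * q * (a * (N + 1ℚ) - 1ℚ)
    ≡⟨ +-vanishing _ (V * q) a[N+1]≡1 ⟩
  closed₁ (V - ½ * a * V) h N S + V * ((h + a) * (h + a))
    ∎
  where
  open ≡-Reasoning
  q : ℚ
  q = + 1 / 3 * (h * h) + + 8 / 9 * h + + 2 / 3 * a - + 16 / 27
  certificate : closed₁ V (h + a) (N + 1ℚ) (S + V * (a * a))
    ≡ closed₁ (V - ½ * a * V) h N S + V * ((h + a) * (h + a)) + V * q * (a * (N + 1ℚ) - 1ℚ)
  certificate = solveℚ 5 (λ V h a N S →
    Poly.closed₁ V (h :+ a) (N :+ con 1ℚ) (S :+ V :* (a :* a))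
    := Poly.closed₁ (V :- con ½ :* a :* V) h N S :+ V :* ((h :+ a) :* (h :+ a))
       :+ V :* (con (+ 1 / 3) :* (h :* h) :+ con (+ 8 / 9) :* h :+ con (+ 2 / 3) :* a :- con (+ 16 / 27))
          :* (a :* (N :+ con 1ℚ) :- con 1ℚ)) refl V h a N S

closed₂-step : ∀ V g a N S → a * (N + 1ℚ) ≡ 1ℚ →
  closed₂ V (g + a * a) (N + 1ℚ) (S + V * (a * a)) ≡ closed₂ (V - ½ * a * V) g N S + V * (g + a * a)
closed₂-step V g a N S a[N+1]≡1 = begin
  closed₂ V (g + a * a) (N + 1ℚ) (S + V * (a * a))
    ≡⟨ certificate ⟩
  closed₂ (V - ½ * a * V) g N S + V * (g + a * a) + V * q * (a * (N + 1ℚ) - 1ℚ)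
    ≡⟨ +-vanishing _ (V * q) a[N+1]≡1 ⟩
  closed₂ (V - ½ * a * V) g N S + V * (g + a * a)
    ∎
  where
  open ≡-Reasoning
  q : ℚ
  q = + 1 / 3 * g + + 2 / 3 * a
  certificate : closed₂ V (g + a * a) (N + 1ℚ) (S + V * (a * a))
    ≡ closed₂ (V - ½ * a * V) g N S + V * (g + a * a) + V * q * (a * (N + 1ℚ) - 1ℚ)
  certificate = solveℚ 5 (λ V g a N S →
    Poly.closed₂ V (g :+ a :* a) (N :+ con 1ℚ) (S :+ V :* (a :* a))
    := Poly.closed₂ (V :- con ½ :* a :* V) g N S :+ V :* (g :+ a :* a)
       :+ V :* (con (+ 1 / 3) :* g :+ con (+ 2 / 3) :* a) :* (a :* (N :+ con 1ℚ) :- con 1ℚ)) refl V g a N S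

sum1to-telescope : ∀ (f F : ℕ → ℚ) → F 0 ≡ 0ℚ → (∀ n → F (suc n) ≡ F n + f (suc n)) →
  ∀ n → sum1to n f ≡ F n
sum1to-telescope f F F0≡0 F-suc zero    = sym F0≡0
sum1to-telescope f F F0≡0 F-suc (suc n) =
  trans (cong (_+ f (suc n)) (sum1to-telescope f F F0≡0 F-suc n)) (sym (F-suc n))

S : ℕ → ℚ
S n = sum1to n (λ k → (2 ^ (2 ℕ.* k)) // ((k ℕ.* k) ℕ.* cbin k))

2^[2k]//[k*k*cbin]≡w*[1/k]² : ∀ k → (2 ^ (2 ℕ.* k)) // ((k ℕ.* k) ℕ.* cbin k) ≡ w k * (1 // k * (1 // k))
2^[2k]//[k*k*cbin]≡w*[1/k]² k = sym (begin
  w k * (1 // k * (1 // k))                          ≡⟨ cong (_*_ (w k)) (//-* 1 k 1 k) ⟩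
  w k * (1 // (k ℕ.* k))                             ≡⟨ //-* (2 ^ (2 ℕ.* k)) (cbin k) 1 (k ℕ.* k) ⟩
  (2 ^ (2 ℕ.* k) ℕ.* 1) // (cbin k ℕ.* (k ℕ.* k))   ≡⟨ cong₂ _//_ (ℕₚ.*-identityʳ _) (ℕₚ.*-comm (cbin k) (k ℕ.* k)) ⟩
  (2 ^ (2 ℕ.* k)) // ((k ℕ.* k) ℕ.* cbin k)          ∎)
  where open ≡-Reasoning

closed₁-suc : ∀ n → closed₁ (w (suc n)) (H (suc n)) (fromℕ (suc n)) (S (suc n))
  ≡ closed₁ (w n) (H n) (fromℕ n) (S n) + w (suc n) * (H (suc n) * H (suc n))
closed₁-suc n = begin
  closed₁ V (H n + a) (fromℕ (suc n)) (S (suc n))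
    ≡⟨ cong₂ (closed₁ V (H n + a)) (fromℕ-suc n) (cong (_+_ (S n)) (2^[2k]//[k*k*cbin]≡w*[1/k]² (suc n))) ⟩
  closed₁ V (H n + a) (fromℕ n + 1ℚ) (S n + V * (a * a))
    ≡⟨ closed₁-step V (H n) a (fromℕ n) (S n) (1//[1+n]*[n+1]≡1 n) ⟩
  closed₁ (V - ½ * a * V) (H n) (fromℕ n) (S n) + V * ((H n + a) * (H n + a))
    ≡⟨ cong (λ W → closed₁ W (H n) (fromℕ n) (S n) + V * ((H n + a) * (H n + a))) (w-pred n) ⟨
  closed₁ (w n) (H n) (fromℕ n) (S n) + V * (H (suc n) * H (suc n))
    ∎
  where
  open ≡-Reasoning
  V a : ℚ
  V = w (suc n)
  a = 1 // suc n

closed₂-suc : ∀ n → closed₂ (w (suc n)) (H2 (suc n)) (fromℕ (suc n)) (S (suc n))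
  ≡ closed₂ (w n) (H2 n) (fromℕ n) (S n) + w (suc n) * H2 (suc n)
closed₂-suc n = begin
  closed₂ V (H2 n + 1 // (suc n ℕ.* suc n)) (fromℕ (suc n)) (S (suc n))
    ≡⟨ cong (λ g → closed₂ V (H2 n + g) (fromℕ (suc n)) (S (suc n))) (//-* 1 (suc n) 1 (suc n)) ⟨
  closed₂ V (H2 n + a * a) (fromℕ (suc n)) (S (suc n))
    ≡⟨ cong₂ (closed₂ V (H2 n + a * a)) (fromℕ-suc n) (cong (_+_ (S n)) (2^[2k]//[k*k*cbin]≡w*[1/k]² (suc n))) ⟩
  closed₂ V (H2 n + a * a) (fromℕ n + 1ℚ) (S n + V * (a * a))
    ≡⟨ closed₂-step V (H2 n) a (fromℕ n) (S n) (1//[1+n]*[n+1]≡1 n) ⟩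
  closed₂ (V - ½ * a * V) (H2 n) (fromℕ n) (S n) + V * (H2 n + a * a)
    ≡⟨ cong₂ (λ W g → closed₂ W (H2 n) (fromℕ n) (S n) + V * (H2 n + g)) (w-pred n) (sym (//-* 1 (suc n) 1 (suc n))) ⟨
  closed₂ (w n) (H2 n) (fromℕ n) (S n) + V * H2 (suc n)
    ∎
  where
  open ≡-Reasoning
  V a : ℚ
  V = w (suc n)
  a = 1 // suc n

sum-w*H² : ∀ n → sum1to n (λ k → w k * (H k * H k)) ≡ closed₁ (w n) (H n) (fromℕ n) (S n)
sum-w*H² = sum1to-telescope _ (λ n → closed₁ (w n) (H n) (fromℕ n) (S n)) refl closed₁-suc

sum-w*H2 : ∀ n → sum1to n (λ k → w k * H2 k) ≡ closed₂ (w n) (H2 n) (fromℕ n) (S n)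
sum-w*H2 = sum1to-telescope _ (λ n → closed₂ (w n) (H2 n) (fromℕ n) (S n)) refl closed₂-suc

2^[2n+1]//[3*cbin]≡⅔*w : ∀ n → (2 ^ (2 ℕ.* n ℕ.+ 1)) // (3 ℕ.* cbin n) ≡ + 2 / 3 * w n
2^[2n+1]//[3*cbin]≡⅔*w n =
  trans (cong (λ e → (2 ^ e) // (3 ℕ.* cbin n)) (ℕₚ.+-comm (2 ℕ.* n) 1)) (sym (//-* 2 3 (2 ^ (2 ℕ.* n)) (cbin n)))

2[2n∸1]//3*H≡⅔[2n-1]*H : ∀ n → (2 ℕ.* (2 ℕ.* n ∸ 1)) // 3 * H n ≡ + 2 / 3 * (+ 2 / 1 * fromℕ n - 1ℚ) * H n
-- At n = 0 the truncated 2n ∸ 1 is wrong, but it is multiplied by H 0 = 0.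
2[2n∸1]//3*H≡⅔[2n-1]*H zero    = refl
2[2n∸1]//3*H≡⅔[2n-1]*H (suc m) = cong (_* H (suc m)) (begin
  (2 ℕ.* (2 ℕ.* suc m ∸ 1)) // 3              ≡⟨ cong (λ k → (2 ℕ.* k) // 3) 2[1+m]∸1≡2m+1 ⟩
  (2 ℕ.* (2 ℕ.* m ℕ.+ 1)) // 3                ≡⟨ //-* 2 3 (2 ℕ.* m ℕ.+ 1) 1 ⟨
  + 2 / 3 * fromℕ (2 ℕ.* m ℕ.+ 1)             ≡⟨ cong (_*_ (+ 2 / 3)) (fromℕ-2n+1 m) ⟩
  + 2 / 3 * (+ 2 / 1 * fromℕ m + 1ℚ)          ≡⟨ cong (_*_ (+ 2 / 3)) (2M+1≡2[M+1]-1 (fromℕ m)) ⟩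
  + 2 / 3 * (+ 2 / 1 * (fromℕ m + 1ℚ) - 1ℚ)   ≡⟨ cong (λ M → + 2 / 3 * (+ 2 / 1 * M - 1ℚ)) (fromℕ-suc m) ⟨
  + 2 / 3 * (+ 2 / 1 * fromℕ (suc m) - 1ℚ)    ∎)
  where
  open ≡-Reasoning
  2[1+m]∸1≡2m+1 : 2 ℕ.* suc m ∸ 1 ≡ 2 ℕ.* m ℕ.+ 1
  2[1+m]∸1≡2m+1 = trans (cong (_∸ 1) (ℕₚ.*-distribˡ-+ 2 1 m)) (ℕₚ.+-comm 1 (2 ℕ.* m))
  2M+1≡2[M+1]-1 : ∀ M → + 2 / 1 * M + 1ℚ ≡ + 2 / 1 * (M + 1ℚ) - 1ℚ
  2M+1≡2[M+1]-1 = solveℚ 1 (λ M → con (+ 2 / 1) :* M :+ con 1ℚ := con (+ 2 / 1) :* (M :+ con 1ℚ) :- con 1ℚ) refl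

corollary5p2 : (n : ℕ) → n ≥ 1 →
    (sum1to n (λ k → w k * (H k * H k))
      ≡ (+ 44 / 27)
        + ((2 ^ (2 ℕ.* n ℕ.+ 1)) // (3 ℕ.* cbin n))
          * ((((+ (n ℕ.+ 1)) / 1) * (H n * H n))
             - ((2 ℕ.* (2 ℕ.* n ℕ.∸ 1)) // 3) * H n
             + ((((+ (8 ℕ.* n)) / 1) - (+ 22 / 1)) * (+ 1 / 9)))
        + (+ 1 / 3) * sum1to n (λ k → (2 ^ (2 ℕ.* k)) // ((k ℕ.* k) ℕ.* cbin k)))
    ×
    (sum1to n (λ k → w k * H2 k)
      ≡ (+ 4 / 3)
        + ((2 ^ (2 ℕ.* n ℕ.+ 1)) // (3 ℕ.* cbin n))
          * ((((+ (n ℕ.+ 1)) / 1) * H2 n) - (+ 2 / 1))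
        + (+ 1 / 3) * sum1to n (λ k → (2 ^ (2 ℕ.* k)) // ((k ℕ.* k) ℕ.* cbin k)))
-- The identities hold for n = 0 as well.
corollary5p2 n _
  rewrite 2^[2n+1]//[3*cbin]≡⅔*w n
        | fromℕ-+ n 1
        | 2[2n∸1]//3*H≡⅔[2n-1]*H n
        | fromℕ-* 8 n
  = sum-w*H² n , sum-w*H2 n
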